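{- Let $N\ge2$. There exists a positive integer $l$, depending only on $N$, such that the following holds: whenever $k_1,\dots,k_{N-1}$ are nonzero integers with $|k_1|,\dots,|k_{N-1}|\ge l$, setting $m=\operatorname{lcm}(k_1,\dots,k_{N-1})$ and $a=\left(m,\frac{m}{k_1},\dots,\frac{m}{k_{N-1}}\right)^t\in\mathbb{Z}^N$, the lattice $\Lambda(a)$ belongs to $\mathcal{R}'_N$.
   Context: $\operatorname{rot}(x_1,\dots,x_N)=(x_N,x_1,\dots,x_{N-1})$. A sublattice $\Gamma\subseteq\mathbb{Z}^N$ is cyclic if $\operatorname{rot}(\Gamma)=\Gamma$; $\mathcal{C}_N$ is the set of full-rank cyclic sublattices of $\mathbb{Z}^N$. For $a\in\mathbb{R}^N$, $\Lambda(a)=\operatorname{span}_{\mathbb{Z}}\{a,\operatorname{rot}(a),\dots,\operatorname{rot}^{N-1}(a)\}$ and the cyclic order $\operatorname{co}(a)$ is the rank of $\Lambda(a)$. $\lambda_i$ are successive minima (Euclidean norm) and $S(\Gamma)$ is the set of vectors of $\Gamma$ of norm $\lambda_1(\Gamma)$. $\mathcal{R}_N=\{\Lambda(a)\in\mathcal{C}_N:\|a\|=\lambda_1(\Lambda(a))=\lambda_N(\Lambda(a))\}$ and $\mathcal{R}'_N=\{\Gamma\in\mathcal{R}_N:\operatorname{co}(c)=N\text{ for all }c\in S(\Gamma)\}$. -}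

module Defs where

open import Data.Nat as ℕ using (ℕ; zero; suc)
open import Data.Integer using (ℤ; _+_; _*_; _≤_; 0ℤ; 1ℤ; +_; NonZero)
open import Data.Integer.LCM using (lcm)
open import Data.Integer.DivMod using (_/_)
open import Data.Fin using (Fin; zero; suc; fromℕ; inject₁; toℕ)
open import Data.Product using (Σ; ∃; _×_; _,_)
open import Relation.Binary.PropositionalEquality using (_≡_)
open import Relation.Nullary using (¬_)

Vecℤ : ℕ → Set
Vecℤ N = Fin N → ℤ

_≐_ : ∀ {N} → Vecℤ N → Vecℤ N → Set
v ≐ w = ∀ i → v i ≡ w i

sumF : ∀ {n} → (Fin n → ℤ) → ℤ
sumF {zero} f = 0ℤ
sumF {suc n} f = f zero + sumF (λ i → f (suc i))

rot : ∀ {N} → Vecℤ N → Vecℤ N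
rot {suc n} x zero = x (fromℕ n)
rot {suc n} x (suc i) = x (inject₁ i)

rotPow : ∀ {N} → ℕ → Vecℤ N → Vecℤ N
rotPow zero x = x
rotPow (suc j) x = rot (rotPow j x)

normSq : ∀ {N} → Vecℤ N → ℤ
normSq v = sumF (λ i → v i * v i)

Sub : ℕ → Set₁
Sub N = Vecℤ N → Set

linComb : ∀ {N k} → (Fin k → Vecℤ N) → (Fin k → ℤ) → Vecℤ N
linComb vs c i = sumF (λ j → c j * vs j i)

Λ : ∀ {N} → Vecℤ N → Sub N
Λ {N} a v = Σ (Fin N → ℤ) λ c → v ≐ linComb (λ j → rotPow (toℕ j) a) c

-- linear independence (over ℤ, equivalently over ℚ/ℝ for integer vectors)
LinIndep : ∀ {N k} → (Fin k → Vecℤ N) → Set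
LinIndep vs = ∀ c → linComb vs c ≐ (λ _ → 0ℤ) → ∀ j → c j ≡ 0ℤ

IndepIn : ∀ {N} → Sub N → ℕ → Set
IndepIn {N} Γ k = Σ (Fin k → Vecℤ N) λ vs → (∀ j → Γ (vs j)) × LinIndep vs

IndepInBall : ∀ {N} → Sub N → ℕ → ℤ → Set
IndepInBall {N} Γ k r =
  Σ (Fin k → Vecℤ N) λ vs → (∀ j → Γ (vs j)) × LinIndep vs × (∀ j → normSq (vs j) ≤ r)

HasRank : ∀ {N} → Sub N → ℕ → Set
HasRank Γ r = IndepIn Γ r × ¬ IndepIn Γ (suc r)

CoIs : ∀ {N} → Vecℤ N → ℕ → Set
CoIs a r = HasRank (Λ a) r

SuccMinSq : ∀ {N} → Sub N → ℕ → ℤ → Set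
SuccMinSq Γ i r = IndepInBall Γ i r × (∀ s → IndepInBall Γ i s → r ≤ s)

Cyclic : ∀ {N} → Sub N → Set
Cyclic {N} Γ = (∀ v → Γ v → Γ (rot v))
             × (∀ w → Γ w → Σ (Vecℤ N) λ v → Γ v × rot v ≐ w)

SameSet : ∀ {N} → Sub N → Sub N → Set
SameSet Γ Δ = ∀ v → (Γ v → Δ v) × (Δ v → Γ v)

InC : (N : ℕ) → Sub N → Set
InC N Γ = Cyclic Γ × HasRank Γ N

InR : (N : ℕ) → Sub N → Set
InR N Γ = Σ (Vecℤ N) λ b → SameSet Γ (Λ b) × InC N (Λ b)
          × SuccMinSq (Λ b) 1 (normSq b) × SuccMinSq (Λ b) N (normSq b)

InS : ∀ {N} → Sub N → Vecℤ N → Set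
InS Γ c = Γ c × SuccMinSq Γ 1 (normSq c)

InR' : (N : ℕ) → Sub N → Set
InR' N Γ = InR N Γ × (∀ c → InS Γ c → CoIs c N)

-- m = lcm(k_1, ..., k_n) (nonnegative, as in the library)
lcmF : ∀ {n} → (Fin n → ℤ) → ℤ
lcmF {zero} k = 1ℤ
lcmF {suc n} k = lcm (k zero) (lcmF (λ i → k (suc i)))

aVec : ∀ {n} (k : Fin n → ℤ) → (∀ i → NonZero (k i)) → Vecℤ (suc n)
aVec k nz zero = lcmF k
aVec k nz (suc i) = (lcmF k / k i) {{nz i}}

module Submission where

-- The rotations rot^t a, t < N, are the rows of a circulant matrix m·I + B whose off-diagonal
-- entries are at most m/L in absolute value, L = 4N + 1. Bounding each cross term by
-- 2L|xyβ| ≤ m(x² + y²) gives L·|Σ c_t rot^t a|² ≥ (2N + 1)·m²·|c|² for every integer vector c,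
-- which is positive for c ≠ 0 and exceeds |a|² ≤ (1 + n/L²)·m² as soon as |c|² ≥ 2. Hence the
-- rotations are independent, they realise both λ₁ and λ_N, and the minimal vectors are exactly
-- the ±rot^j a, whose own rotations are again independent. For the lcm vector, |k_i| ≥ L makes
-- every entry m/k_i at most m/L.

open import Defs
open import Data.Nat as ℕ using (ℕ; zero; suc)
import Data.Nat.Properties as ℕ
open import Data.Nat.DivMod using ([m+kn]%n≡m%n; m<n⇒m%n≡m; m/n*n≤m)
open import Data.Nat.GCD using (gcd)
open import Data.Nat.LCM using (lcm; gcd*lcm)
open import Data.Integer hiding (suc; _%_)
open import Data.Integer.Properties
open import Data.Integer.Tactic.RingSolver using (solve-∀)
open import Data.Fin using (Fin; zero; suc; fromℕ; inject₁; toℕ; punchIn)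
import Data.Fin.Properties as Fin
open import Data.Fin.Properties using (all?; ¬∀⟶∃¬)
open import Data.Product using (Σ; ∃; _×_; _,_; proj₁)
open import Data.Sum using (_⊎_; inj₁; inj₂)
open import Data.Empty using (⊥-elim)
open import Data.Vec.Functional using (insertAt)
open import Data.Vec.Functional.Properties using (insertAt-lookup; insertAt-punchIn)
open import Function using (_∘_)
open import Relation.Nullary using (¬_; yes; no)
open import Relation.Binary.PropositionalEquality

sumF-cong : ∀ {n} {f g : Fin n → ℤ} → (∀ i → f i ≡ g i) → sumF f ≡ sumF g
sumF-cong {zero}  e = refl
sumF-cong {suc n} e = cong₂ _+_ (e zero) (sumF-cong (e ∘ suc))

sumF-zero : ∀ {n} → sumF {n} (λ _ → 0ℤ) ≡ 0ℤ
sumF-zero {zero}  = refl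
sumF-zero {suc n} = trans (+-identityˡ _) (sumF-zero {n})

sumF-+ : ∀ {n} (f g : Fin n → ℤ) → sumF (λ i → f i + g i) ≡ sumF f + sumF g
sumF-+ {zero}  f g = refl
sumF-+ {suc n} f g =
  trans (cong (_+_ (f zero + g zero)) (sumF-+ (f ∘ suc) (g ∘ suc))) (interchange (f zero) (g zero) (sumF (f ∘ suc)) (sumF (g ∘ suc)))
  where
  interchange : ∀ a b c d → a + b + (c + d) ≡ a + c + (b + d)
  interchange = solve-∀

sumF-*ˡ : ∀ {n} a (f : Fin n → ℤ) → sumF (λ i → a * f i) ≡ a * sumF f
sumF-*ˡ {zero}  a f = sym (*-zeroʳ a)
sumF-*ˡ {suc n} a f =
  trans (cong (_+_ (a * f zero)) (sumF-*ˡ a (f ∘ suc))) (sym (*-distribˡ-+ a _ _))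

sumF-const : ∀ {n} x → sumF {n} (λ _ → x) ≡ + n * x
sumF-const {zero}  x = refl
sumF-const {suc n} x =
  trans (cong (_+_ x) (sumF-const {n} x)) (trans (cong (_+ + n * x) (sym (*-identityˡ x)))
    (trans (sym (*-distribʳ-+ x 1ℤ (+ n))) (cong (_* x) (sym (pos-+ 1 n)))))

sumF-mono : ∀ {n} {f g : Fin n → ℤ} → (∀ i → f i ≤ g i) → sumF f ≤ sumF g
sumF-mono {zero}  le = ≤-refl
sumF-mono {suc n} le = +-mono-≤ (le zero) (sumF-mono (le ∘ suc))

sumF-nonNeg : ∀ {n} {f : Fin n → ℤ} → (∀ i → 0ℤ ≤ f i) → 0ℤ ≤ sumF f
sumF-nonNeg {n} {f} le = subst (_≤ sumF f) (sumF-zero {n}) (sumF-mono le)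

sumF-last : ∀ {n} (f : Fin (suc n) → ℤ) → sumF f ≡ sumF (f ∘ inject₁) + f (fromℕ n)
sumF-last {zero}  f = +-comm (f zero) 0ℤ
sumF-last {suc n} f =
  trans (cong (_+_ (f zero)) (sumF-last (f ∘ suc))) (sym (+-assoc (f zero) _ _))

sumF-punchIn : ∀ {n} p (f : Fin (suc n) → ℤ) → sumF f ≡ f p + sumF (f ∘ punchIn p)
sumF-punchIn           zero    f = refl
sumF-punchIn {suc n} (suc p) f =
  trans (cong (_+_ (f zero)) (sumF-punchIn p (f ∘ suc))) (swap (f zero) (f (suc p)) _)
  where
  swap : ∀ a b c → a + (b + c) ≡ b + (a + c)
  swap = solve-∀

sumF-single : ∀ {n} p (f : Fin n → ℤ) → (∀ j → j ≢ p → f j ≡ 0ℤ) → sumF f ≡ f p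
sumF-single {suc n} p f vanish = begin
  sumF f                     ≡⟨ sumF-punchIn p f ⟩
  f p + sumF (f ∘ punchIn p) ≡⟨ cong (_+_ (f p)) (sumF-cong (λ j → vanish _ (Fin.punchInᵢ≢i p j))) ⟩
  f p + sumF {n} (λ _ → 0ℤ) ≡⟨ cong (_+_ (f p)) (sumF-zero {n}) ⟩
  f p + 0ℤ                   ≡⟨ +-identityʳ (f p) ⟩
  f p                        ∎
  where open ≡-Reasoning

-- Rotation as a permutation of indices

back : ∀ {n} → Fin (suc n) → Fin (suc n)
back {n} zero    = fromℕ n
back     (suc i) = inject₁ i

back^ : ∀ {n} → ℕ → Fin (suc n) → Fin (suc n)
back^ zero    i = i
back^ (suc t) i = back^ t (back i)

rot-back : ∀ {n} (x : Vecℤ (suc n)) i → rot x i ≡ x (back i)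
rot-back x zero    = refl
rot-back x (suc i) = refl

rotPow-back^ : ∀ {n} t (x : Vecℤ (suc n)) i → rotPow t x i ≡ x (back^ t i)
rotPow-back^ zero    x i = refl
rotPow-back^ (suc t) x i = trans (rot-back (rotPow t x) i) (rotPow-back^ t x (back i))

sumF-back : ∀ {n} (f : Fin (suc n) → ℤ) → sumF (f ∘ back) ≡ sumF f
sumF-back {n} f = trans (+-comm (f (fromℕ n)) _) (sym (sumF-last f))

back-congruent : ∀ {n} (j : Fin (suc n)) → ∃ λ q → toℕ (back j) ℕ.+ 1 ≡ toℕ j ℕ.+ q ℕ.* suc n
back-congruent {n} zero    = 1 , trans (cong (ℕ._+ 1) (Fin.toℕ-fromℕ n))
                                   (trans (ℕ.+-comm n 1) (cong suc (sym (ℕ.+-identityʳ n))))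
back-congruent     (suc i) = 0 , trans (cong (ℕ._+ 1) (Fin.toℕ-inject₁ i))
                                   (trans (ℕ.+-comm (toℕ i) 1) (sym (ℕ.+-identityʳ _)))

back^-congruent : ∀ {n} t (j : Fin (suc n)) → ∃ λ q → toℕ (back^ t j) ℕ.+ t ≡ toℕ j ℕ.+ q ℕ.* suc n
back^-congruent zero j = 0 , refl
back^-congruent {n} (suc t) j with back^-congruent t (back j) | back-congruent j
... | q , e₁ | r , e₂ = r ℕ.+ q , (begin
  toℕ (back^ t (back j)) ℕ.+ suc t         ≡⟨ ℕ.+-suc _ t ⟩
  suc (toℕ (back^ t (back j)) ℕ.+ t)       ≡⟨ cong suc e₁ ⟩
  suc (toℕ (back j) ℕ.+ q ℕ.* suc n)       ≡⟨ cong (ℕ._+ q ℕ.* suc n) (trans (ℕ.+-comm 1 _) e₂) ⟩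
  toℕ j ℕ.+ r ℕ.* suc n ℕ.+ q ℕ.* suc n    ≡⟨ ℕ.+-assoc (toℕ j) _ _ ⟩
  toℕ j ℕ.+ (r ℕ.* suc n ℕ.+ q ℕ.* suc n)  ≡⟨ cong (toℕ j ℕ.+_) (ℕ.*-distribʳ-+ (suc n) r q) ⟨
  toℕ j ℕ.+ (r ℕ.+ q) ℕ.* suc n            ∎)
  where open ≡-Reasoning

remainder-unique : ∀ {N a b c q} .{{_ : ℕ.NonZero N}} → a ℕ.< N → b ℕ.< N →
                   a ℕ.+ c ℕ.* N ≡ b ℕ.+ q ℕ.* N → a ≡ b
remainder-unique {N} {a} {b} {c} {q} a<N b<N e = begin
  a                       ≡⟨ m<n⇒m%n≡m a<N ⟨
  a ℕ.% N                 ≡⟨ [m+kn]%n≡m%n a c N ⟨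
  (a ℕ.+ c ℕ.* N) ℕ.% N   ≡⟨ cong (ℕ._% N) e ⟩
  (b ℕ.+ q ℕ.* N) ℕ.% N   ≡⟨ [m+kn]%n≡m%n b q N ⟩
  b ℕ.% N                 ≡⟨ m<n⇒m%n≡m b<N ⟩
  b                       ∎
  where open ≡-Reasoning

back^-period : ∀ {n} (j : Fin (suc n)) → back^ (suc n) j ≡ j
back^-period {n} j with back^-congruent (suc n) j
... | q , e = Fin.toℕ-injective (remainder-unique {c = 1} {q = q} (Fin.toℕ<n _) (Fin.toℕ<n j)
                (trans (cong (toℕ (back^ (suc n) j) ℕ.+_) (ℕ.+-identityʳ (suc n))) e))

back^-self : ∀ {n} (i : Fin (suc n)) → back^ (toℕ i) i ≡ zero
back^-self i with back^-congruent (toℕ i) i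
... | q , e = Fin.toℕ-injective (remainder-unique {c = 0} {q = q} (Fin.toℕ<n (back^ (toℕ i) i)) (ℕ.s≤s ℕ.z≤n)
                (trans (ℕ.+-identityʳ _) (ℕ.+-cancelʳ-≡ (toℕ i) _ _ (trans e (ℕ.+-comm (toℕ i) _)))))

back^-zero⇒ : ∀ {n} (t i : Fin (suc n)) → back^ (toℕ t) i ≡ zero → t ≡ i
back^-zero⇒ t i z with back^-congruent (toℕ t) i
... | q , e rewrite z = Fin.toℕ-injective (remainder-unique {c = 0} {q = q} (Fin.toℕ<n t) (Fin.toℕ<n i)
                          (trans (ℕ.+-identityʳ (toℕ t)) e))

rotPow-+ : ∀ {N} s t (x : Vecℤ N) → rotPow (s ℕ.+ t) x ≡ rotPow s (rotPow t x)
rotPow-+ zero    t x = refl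
rotPow-+ (suc s) t x = cong rot (rotPow-+ s t x)

rotPow-period : ∀ {n} (x : Vecℤ (suc n)) → rotPow (suc n) x ≐ x
rotPow-period {n} x i = trans (rotPow-back^ (suc n) x i) (cong x (back^-period i))

-- Linear dependence

LinDep : ∀ {N k} → (Fin k → Vecℤ N) → Set
LinDep vs = ∃ λ c → linComb vs c ≐ (λ _ → 0ℤ) × ∃ λ j → c j ≢ 0ℤ

linDep⇒¬linIndep : ∀ {N k} {vs : Fin k → Vecℤ N} → LinDep vs → ¬ LinIndep vs
linDep⇒¬linIndep (c , vanish , j , cj≢0) indep = cj≢0 (indep c vanish j)

linComb-zero : ∀ {N k} (vs : Fin k → Vecℤ N) {c : Fin k → ℤ} → (∀ t → c t ≡ 0ℤ) →
               linComb vs c ≐ (λ _ → 0ℤ)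
linComb-zero {k = k} vs c≡0 i =
  trans (sumF-cong (λ t → cong (_* vs t i) (c≡0 t))) (sumF-zero {k})

linComb-single : ∀ {N k} (vs : Fin k → Vecℤ N) (c : Fin k → ℤ) j → (∀ t → t ≢ j → c t ≡ 0ℤ) →
                 linComb vs c ≐ (λ i → c j * vs j i)
linComb-single vs c j vanish i = sumF-single j _ (λ t t≢j → cong (_* vs t i) (vanish t t≢j))

linDep-dropFirst : ∀ {M k} (vs : Fin (suc k) → Vecℤ (suc M)) → (∀ p → vs p zero ≡ 0ℤ) →
                   LinDep (λ j i → vs (suc j) (suc i)) → LinDep vs
linDep-dropFirst {k = k} vs first≡0 (d , vanish , j , dj≢0) = c , combination , suc j , dj≢0
  where
  c : Fin _ → ℤ
  c zero    = 0ℤ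
  c (suc j) = d j
  combination : linComb vs c ≐ (λ _ → 0ℤ)
  combination zero    = trans (+-identityˡ _)
    (trans (sumF-cong (λ j → trans (cong (d j *_) (first≡0 (suc j))) (*-zeroʳ (d j)))) (sumF-zero {k}))
  combination (suc i) = trans (+-identityˡ _) (vanish i)

eliminate : ∀ {M k} → (Fin (suc k) → Vecℤ (suc M)) → Fin (suc k) → Fin k → Vecℤ M
eliminate vs p j i = vs p zero * vs (punchIn p j) (suc i) - vs (punchIn p j) zero * vs p (suc i)

sumF-*-difference : ∀ {k} x z (d f g : Fin k → ℤ) →
  sumF (λ j → d j * (x * f j - g j * z)) ≡ x * sumF (λ j → d j * f j) - z * sumF (λ j → d j * g j)
sumF-*-difference {k} x z d f g = begin
  sumF (λ j → d j * (x * f j - g j * z))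
    ≡⟨ sumF-cong (λ j → expand x z (d j) (f j) (g j)) ⟩
  sumF (λ j → x * (d j * f j) + - z * (d j * g j))
    ≡⟨ sumF-+ {k} _ _ ⟩
  sumF (λ j → x * (d j * f j)) + sumF (λ j → - z * (d j * g j))
    ≡⟨ cong₂ _+_ (sumF-*ˡ {k} x _) (sumF-*ˡ {k} (- z) _) ⟩
  x * sumF (λ j → d j * f j) + - z * sumF (λ j → d j * g j)
    ≡⟨ cong (_+_ (x * _)) (neg-distribˡ-* z _) ⟨
  x * sumF (λ j → d j * f j) - z * sumF (λ j → d j * g j) ∎
  where
  open ≡-Reasoning
  expand : ∀ x z d a b → d * (x * a - b * z) ≡ x * (d * a) + - z * (d * b)
  expand = solve-∀

-- A dependence d of the eliminated vectors lifts to x·Σ d_j u_j - (Σ d_j u_j(0))·vs p,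
-- with x = vs p 0 the pivot and u_j the remaining vectors.
linDep-eliminate : ∀ {M k} (vs : Fin (suc k) → Vecℤ (suc M)) p → vs p zero ≢ 0ℤ →
                   LinDep (eliminate vs p) → LinDep vs
linDep-eliminate {M} {k} vs p x≢0 (d , vanish , j , dj≢0) = c , combination , punchIn p j , cj≢0
  where
  x = vs p zero
  u : Fin k → Vecℤ (suc M)
  u j = vs (punchIn p j)
  y = - sumF (λ j → d j * u j zero)
  c : Fin (suc k) → ℤ
  c = insertAt (λ j → x * d j) p y
  cj≢0 : c (punchIn p j) ≢ 0ℤ
  cj≢0 e with i*j≡0⇒i≡0∨j≡0 x (trans (sym (insertAt-punchIn (λ j → x * d j) p y j)) e)
  ... | inj₁ x≡0  = x≢0 x≡0
  ... | inj₂ dj≡0 = dj≢0 dj≡0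
  split : ∀ i → linComb vs c i ≡ y * vs p i + x * sumF (λ j → d j * u j i)
  split i = begin
    sumF (λ t → c t * vs t i)
      ≡⟨ sumF-punchIn p (λ t → c t * vs t i) ⟩
    c p * vs p i + sumF (λ j → c (punchIn p j) * u j i)
      ≡⟨ cong₂ _+_ (cong (_* vs p i) (insertAt-lookup _ p y))
                   (sumF-cong (λ j → trans (cong (_* u j i) (insertAt-punchIn _ p y j)) (*-assoc x (d j) (u j i)))) ⟩
    y * vs p i + sumF (λ j → x * (d j * u j i))
      ≡⟨ cong (_+_ (y * vs p i)) (sumF-*ˡ {k} x _) ⟩
    y * vs p i + x * sumF (λ j → d j * u j i) ∎
    where open ≡-Reasoning
  combination : linComb vs c ≐ (λ _ → 0ℤ)
  combination zero    = trans (split zero) (cancel x (sumF (λ j → d j * u j zero)))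
    where
    cancel : ∀ x s → - s * x + x * s ≡ 0ℤ
    cancel = solve-∀
  combination (suc i) = trans (split (suc i)) (trans (rearrange x (vs p (suc i)) _ _) (trans (sym (sumF-*-difference x (vs p (suc i)) d _ _)) (vanish i)))
    where
    rearrange : ∀ x z s t → - s * z + x * t ≡ x * t - z * s
    rearrange = solve-∀

linDep-overfull : ∀ N (vs : Fin (suc N) → Vecℤ N) → LinDep vs
linDep-overfull zero    vs = (λ _ → 1ℤ) , (λ ()) , zero , (λ ())
linDep-overfull (suc M) vs with all? (λ p → vs p zero ≟ 0ℤ)
... | yes first≡0 = linDep-dropFirst vs first≡0 (linDep-overfull M (λ j i → vs (suc j) (suc i)))
... | no ¬first≡0 with ¬∀⟶∃¬ _ _ (λ p → vs p zero ≟ 0ℤ) ¬first≡0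
...   | p , x≢0 = linDep-eliminate vs p x≢0 (linDep-overfull M (eliminate vs p))

square-nonNeg : ∀ x → 0ℤ ≤ x * x
square-nonNeg +0       = ≤-refl
square-nonNeg +[1+ a ] = +≤+ ℕ.z≤n
square-nonNeg -[1+ a ] = +≤+ ℕ.z≤n

square-pos : ∀ x → x ≢ 0ℤ → 1ℤ ≤ x * x
square-pos +0       x≢0 = ⊥-elim (x≢0 refl)
square-pos +[1+ a ] _   = +≤+ (ℕ.s≤s ℕ.z≤n)
square-pos -[1+ a ] _   = +≤+ (ℕ.s≤s ℕ.z≤n)

IsUnit : ℤ → Set
IsUnit s = s ≡ 1ℤ ⊎ s ≡ -1ℤ

square≡1⇒isUnit : ∀ x → x * x ≡ 1ℤ → IsUnit x
square≡1⇒isUnit +[1+ 0 ]     _ = inj₁ refl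
square≡1⇒isUnit -[1+ 0 ]     _ = inj₂ refl
square≡1⇒isUnit +[1+ suc a ] ()
square≡1⇒isUnit -[1+ suc a ] ()

isUnit-cancel : ∀ {s} → IsUnit s → ∀ x → s * x ≡ 0ℤ → x ≡ 0ℤ
isUnit-cancel (inj₁ refl) x e = trans (sym (*-identityˡ x)) e
isUnit-cancel (inj₂ refl) x e = neg-injective (trans (sym (-1*i≡-i x)) e)

normSq-nonNeg : ∀ {n} (c : Vecℤ n) → 0ℤ ≤ normSq c
normSq-nonNeg c = sumF-nonNeg (λ i → square-nonNeg (c i))

normSq-cong : ∀ {n} {x y : Vecℤ n} → x ≐ y → normSq x ≡ normSq y
normSq-cong e = sumF-cong (λ i → cong₂ _*_ (e i) (e i))

normSq-zero : ∀ {n} {x : Vecℤ n} → x ≐ (λ _ → 0ℤ) → normSq x ≡ 0ℤ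
normSq-zero {n} e = trans (normSq-cong e) (sumF-zero {n})

square≤normSq : ∀ {n} (c : Vecℤ n) j → c j * c j ≤ normSq c
square≤normSq {suc n} c j = begin
  c j * c j                                 ≡⟨ +-identityʳ _ ⟨
  c j * c j + 0ℤ                            ≤⟨ +-monoʳ-≤ (c j * c j) (normSq-nonNeg (c ∘ punchIn j)) ⟩
  c j * c j + normSq (c ∘ punchIn j)        ≡⟨ sumF-punchIn j (λ i → c i * c i) ⟨
  normSq c                                  ∎
  where open ≤-Reasoning

normSq≡0⇒zero : ∀ {n} (c : Vecℤ n) → normSq c ≡ 0ℤ → ∀ i → c i ≡ 0ℤ
normSq≡0⇒zero c e i with i*j≡0⇒i≡0∨j≡0 (c i)
  (≤-antisym (subst (c i * c i ≤_) e (square≤normSq c i)) (square-nonNeg (c i)))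
... | inj₁ ci≡0 = ci≡0
... | inj₂ ci≡0 = ci≡0

normSq-trichotomy : ∀ {n} (c : Vecℤ n) → normSq c ≡ 0ℤ ⊎ normSq c ≡ 1ℤ ⊎ + 2 ≤ normSq c
normSq-trichotomy c with normSq c | normSq-nonNeg c
... | +0            | _ = inj₁ refl
... | +[1+ 0 ]      | _ = inj₂ (inj₁ refl)
... | +[1+ suc k ]  | _ = inj₂ (inj₂ (+≤+ (ℕ.s≤s (ℕ.s≤s ℕ.z≤n))))

SignedBasis : ∀ {n} → Vecℤ n → Set
SignedBasis {n} c = ∃ λ (j : Fin n) → ∃ λ s → IsUnit s × c j ≡ s × (∀ i → i ≢ j → c i ≡ 0ℤ)

normSq≡1⇒signedBasis : ∀ {n} (c : Vecℤ n) → normSq c ≡ 1ℤ → SignedBasis c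
normSq≡1⇒signedBasis {suc n} c e with c zero ≟ 0ℤ
... | yes c₀≡0 with normSq≡1⇒signedBasis (c ∘ suc) (trans (sym (+-identityˡ _))
                      (trans (cong (λ z → z * z + normSq (c ∘ suc)) (sym c₀≡0)) e))
...   | j , s , unit , cj≡s , off-j≡0 = suc j , s , unit , cj≡s , λ
          { zero    _   → c₀≡0
          ; (suc i) i≢j → off-j≡0 i (i≢j ∘ cong suc) }
normSq≡1⇒signedBasis {suc n} c e | no c₀≢0 =
  zero , c zero , square≡1⇒isUnit (c zero) c₀²≡1 , refl , λ
    { zero    0≢0 → ⊥-elim (0≢0 refl)
    ; (suc i) _   → normSq≡0⇒zero (c ∘ suc) tail≡0 i }
  where
  tail≡0 : normSq (c ∘ suc) ≡ 0ℤ
  tail≡0 = ≤-antisym (0≤i-j⇒j≤i (subst (0ℤ ≤_) gap (i≤j⇒0≤j-i (square-pos (c zero) c₀≢0))))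
                     (normSq-nonNeg (c ∘ suc))
    where
    difference : ∀ a t → a - (a + t) ≡ 0ℤ - t
    difference = solve-∀
    gap : c zero * c zero - 1ℤ ≡ 0ℤ - normSq (c ∘ suc)
    gap = trans (cong (_-_ (c zero * c zero)) (sym e)) (difference (c zero * c zero) (normSq (c ∘ suc)))
  c₀²≡1 : c zero * c zero ≡ 1ℤ
  c₀²≡1 = trans (sym (+-identityʳ _)) (trans (cong (_+_ (c zero * c zero)) (sym tail≡0)) e)

orbit : ∀ {N} → Vecℤ N → Fin N → Vecℤ N
orbit a t = rotPow (toℕ t) a

normSq-rotPow : ∀ {n} t (x : Vecℤ (suc n)) → normSq (rotPow t x) ≡ normSq x
normSq-rotPow zero    x = refl
normSq-rotPow (suc t) x = begin
  normSq (rot (rotPow t x))                  ≡⟨ sumF-cong (λ i → cong₂ _*_ (rot-back y i) (rot-back y i)) ⟩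
  sumF ((λ i → y i * y i) ∘ back)            ≡⟨ sumF-back (λ i → y i * y i) ⟩
  normSq y                                   ≡⟨ normSq-rotPow t x ⟩
  normSq x                                   ∎
  where
  open ≡-Reasoning
  y = rotPow t x

normSq-scale : ∀ {n s} → IsUnit s → (x : Vecℤ n) → normSq (λ i → s * x i) ≡ normSq x
normSq-scale (inj₁ refl) x = sumF-cong (λ i → square-unit (x i))
  where
  square-unit : ∀ a → 1ℤ * a * (1ℤ * a) ≡ a * a
  square-unit = solve-∀
normSq-scale (inj₂ refl) x = sumF-cong (λ i → square-unit (x i))
  where
  square-unit : ∀ a → -1ℤ * a * (-1ℤ * a) ≡ a * a
  square-unit = solve-∀

rotPow-cong : ∀ {n} t {x y : Vecℤ (suc n)} → x ≐ y → rotPow t x ≐ rotPow t y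
rotPow-cong t {x} {y} e i = trans (rotPow-back^ t x i) (trans (e _) (sym (rotPow-back^ t y i)))

rotPow-linComb : ∀ {n k} t (vs : Fin k → Vecℤ (suc n)) c →
                 rotPow t (linComb vs c) ≐ linComb (rotPow t ∘ vs) c
rotPow-linComb t vs c i = trans (rotPow-back^ t (linComb vs c) i)
  (sumF-cong (λ j → cong (c j *_) (sym (rotPow-back^ t (vs j) i))))

rotPow-scale : ∀ {n} t s (x : Vecℤ (suc n)) → rotPow t (λ i → s * x i) ≐ (λ i → s * rotPow t x i)
rotPow-scale t s x i = trans (rotPow-back^ t _ i) (cong (s *_) (sym (rotPow-back^ t x i)))

rotPow-comm : ∀ {N} s t (x : Vecℤ N) → rotPow s (rotPow t x) ≡ rotPow t (rotPow s x)
rotPow-comm s t x = trans (sym (rotPow-+ s t x)) (trans (cong (λ u → rotPow u x) (ℕ.+-comm s t)) (rotPow-+ t s x))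

rotPow-zero⇒zero : ∀ {n} (t : Fin (suc n)) (x : Vecℤ (suc n)) →
                   rotPow (toℕ t) x ≐ (λ _ → 0ℤ) → x ≐ (λ _ → 0ℤ)
rotPow-zero⇒zero {n} t x vanish i = begin
  x i                                       ≡⟨ rotPow-period x i ⟨
  rotPow (suc n) x i                        ≡⟨ cong (λ u → rotPow u x i) (ℕ.m∸n+n≡m (ℕ.<⇒≤ (Fin.toℕ<n t))) ⟨
  rotPow (suc n ℕ.∸ toℕ t ℕ.+ toℕ t) x i    ≡⟨ cong (λ v → v i) (rotPow-+ (suc n ℕ.∸ toℕ t) (toℕ t) x) ⟩
  rotPow (suc n ℕ.∸ toℕ t) (rotPow (toℕ t) x) i ≡⟨ rotPow-cong (suc n ℕ.∸ toℕ t) vanish i ⟩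
  rotPow (suc n ℕ.∸ toℕ t) (λ _ → 0ℤ) i     ≡⟨ rotPow-back^ (suc n ℕ.∸ toℕ t) _ i ⟩
  0ℤ                                        ∎
  where open ≡-Reasoning

δ : ∀ {k} → Fin k → Fin k → ℤ
δ j t with t Fin.≟ j
... | yes _ = 1ℤ
... | no  _ = 0ℤ

δ-diag : ∀ {k} (j : Fin k) → δ j j ≡ 1ℤ
δ-diag j with j Fin.≟ j
... | yes _  = refl
... | no j≢j = ⊥-elim (j≢j refl)

δ-offDiag : ∀ {k} (j t : Fin k) → t ≢ j → δ j t ≡ 0ℤ
δ-offDiag j t t≢j with t Fin.≟ j
... | yes t≡j = ⊥-elim (t≢j t≡j)
... | no  _   = refl

linComb-δ : ∀ {N k} (vs : Fin k → Vecℤ N) j → linComb vs (δ j) ≐ vs j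
linComb-δ vs j i = trans (linComb-single vs (δ j) j (δ-offDiag j) i)
                         (trans (cong (_* vs j i) (δ-diag j)) (*-identityˡ _))

linIndep⇒nonzero : ∀ {N k} {vs : Fin k → Vecℤ N} → LinIndep vs → ∀ j → ¬ (vs j ≐ (λ _ → 0ℤ))
linIndep⇒nonzero {vs = vs} indep j vanish
  with trans (sym (δ-diag j)) (indep (δ j) (λ i → trans (linComb-δ vs j i) (vanish i)) j)
... | ()

sumF-*δ : ∀ {k} (c : Fin k → ℤ) i → sumF (λ t → c t * δ i t) ≡ c i
sumF-*δ c i = trans (sumF-single i _ (λ t t≢i → trans (cong (c t *_) (δ-offDiag i t t≢i)) (*-zeroʳ (c t))))
                    (trans (cong (c i *_) (δ-diag i)) (*-identityʳ (c i)))

linIndep-single : ∀ {N} (v : Vecℤ N) j → v j ≢ 0ℤ → LinIndep (λ (_ : Fin 1) → v)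
linIndep-single v j vj≢0 c vanish zero with i*j≡0⇒i≡0∨j≡0 (c zero) (trans (sym (+-identityʳ _)) (vanish j))
... | inj₁ c₀≡0 = c₀≡0
... | inj₂ vj≡0 = ⊥-elim (vj≢0 vj≡0)

linComb-cong : ∀ {N k} {vs ws : Fin k → Vecℤ N} → (∀ t → vs t ≐ ws t) → ∀ c → linComb vs c ≐ linComb ws c
linComb-cong e c i = sumF-cong (λ t → cong (c t *_) (e t i))

linComb-scale : ∀ {N k} s (vs : Fin k → Vecℤ N) c → linComb (λ t i → s * vs t i) c ≐ (λ i → s * linComb vs c i)
linComb-scale {k = k} s vs c i = trans (sumF-cong (λ t → swap (c t) s (vs t i))) (sumF-*ˡ {k} s _)
  where
  swap : ∀ c s v → c * (s * v) ≡ s * (c * v)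
  swap = solve-∀

orbit∈Λ : ∀ {N} (a : Vecℤ N) j → Λ a (orbit a j)
orbit∈Λ a j = δ j , λ i → sym (linComb-δ (orbit a) j i)

hasRank-full : ∀ {N} {Γ : Sub N} (vs : Fin N → Vecℤ N) → (∀ j → Γ (vs j)) → LinIndep vs → HasRank Γ N
hasRank-full {N} vs mem indep =
  (vs , mem , indep) , λ (ws , _ , indep′) → linDep⇒¬linIndep {vs = ws} (linDep-overfull N ws) indep′

orbit-back : ∀ {n} (a : Vecℤ (suc n)) t i → orbit a (back t) (back i) ≡ orbit a t i
orbit-back {n} a t i =
  trans (rotPow-back^ (toℕ (back t)) a (back i)) (trans (cong a (index t)) (sym (rotPow-back^ (toℕ t) a i)))
  where
  index : ∀ t → back^ (toℕ (back t)) (back i) ≡ back^ (toℕ t) i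
  index zero     = trans (cong (λ k → back^ k (back i)) (Fin.toℕ-fromℕ n)) (back^-period i)
  index (suc t′) = cong (λ k → back^ k (back i)) (Fin.toℕ-inject₁ t′)

Λ-rot : ∀ {n} (a : Vecℤ (suc n)) v → Λ a v → Λ a (rot v)
Λ-rot a v (c , v≐) = c ∘ back , λ i → begin
  rot v i                                             ≡⟨ rot-back v i ⟩
  v (back i)                                          ≡⟨ v≐ (back i) ⟩
  sumF (λ t → c t * orbit a t (back i))               ≡⟨ sumF-back (λ t → c t * orbit a t (back i)) ⟨
  sumF (λ t → c (back t) * orbit a (back t) (back i)) ≡⟨ sumF-cong (λ t → cong (c (back t) *_) (orbit-back a t i)) ⟩
  linComb (orbit a) (c ∘ back) i                      ∎
  where open ≡-Reasoning

Λ-rotPow : ∀ {n} (a : Vecℤ (suc n)) t v → Λ a v → Λ a (rotPow t v)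
Λ-rotPow a zero    v v∈Λ = v∈Λ
Λ-rotPow a (suc t) v v∈Λ = Λ-rot a (rotPow t v) (Λ-rotPow a t v v∈Λ)

Λ-cyclic : ∀ {n} (a : Vecℤ (suc n)) → Cyclic (Λ a)
Λ-cyclic {n} a = Λ-rot a , λ w w∈Λ → rotPow n w , Λ-rotPow a n w w∈Λ , rotPow-period w

-- The rotations of ±rot^j a are ±rot^j applied to those of a, and ±rot^j is injective.
co-signedRotation : ∀ {n} (a : Vecℤ (suc n)) → LinIndep (orbit a) → ∀ j {s} → IsUnit s →
                    ∀ c → c ≐ (λ i → s * orbit a j i) → CoIs c (suc n)
co-signedRotation a indep j {s} unit c c≐ = hasRank-full {Γ = Λ c} (orbit c) (orbit∈Λ c) indep-c
  where
  r = rotPow (toℕ j)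
  orbit-c : ∀ t → orbit c t ≐ (λ i → s * r (orbit a t) i)
  orbit-c t i = trans (rotPow-cong (toℕ t) c≐ i)
    (trans (rotPow-scale (toℕ t) s (r a) i) (cong (λ v → s * v i) (rotPow-comm (toℕ t) (toℕ j) a)))
  indep-c : LinIndep (orbit c)
  indep-c f vanish = indep f (rotPow-zero⇒zero j _ λ i → begin
    r (linComb (orbit a) f) i                     ≡⟨ rotPow-linComb (toℕ j) (orbit a) f i ⟩
    linComb (r ∘ orbit a) f i                     ≡⟨ isUnit-cancel unit _ (begin
      s * linComb (r ∘ orbit a) f i                 ≡⟨ linComb-scale s (r ∘ orbit a) f i ⟨
      linComb (λ t i → s * r (orbit a t) i) f i     ≡⟨ linComb-cong orbit-c f i ⟨
      linComb (orbit c) f i                         ≡⟨ vanish i ⟩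
      0ℤ                                            ∎) ⟩
    0ℤ                                            ∎)
    where open ≡-Reasoning

-- The estimate for a perturbed multiple of the identity

dot : ∀ {N} → Vecℤ N → Vecℤ N → ℤ
dot x y = sumF (λ i → x i * y i)

*-nonNeg : ∀ {p x} → 0ℤ ≤ p → 0ℤ ≤ x → 0ℤ ≤ p * x
*-nonNeg {p} {x} 0≤p 0≤x = subst (_≤ p * x) (*-zeroʳ p) (*-monoˡ-≤-nonNeg p {{nonNegative 0≤p}} 0≤x)

nat-nonNeg : ∀ n → 0ℤ ≤ + n
nat-nonNeg n = +≤+ ℕ.z≤n

+-nonNeg : ∀ {x y} → 0ℤ ≤ x → 0ℤ ≤ y → 0ℤ ≤ x + y
+-nonNeg = +-mono-≤

split-below : ∀ {M L b} → L ℕ.* b ℕ.≤ M → + M ≡ + L * + b + + (M ℕ.∸ L ℕ.* b)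
split-below {M} {L} {b} le =
  trans (cong +_ (sym (ℕ.m+[n∸m]≡n le))) (trans (pos-+ (L ℕ.* b) _) (cong (_+ + (M ℕ.∸ L ℕ.* b)) (pos-* L b)))

-- M(x² + y²) + 2Lxyβ = L|β|(x ± y)² + (M - L|β|)(x² + y²), with ± the sign of β
cross-term-bound : ∀ (M L : ℕ) x y β → L ℕ.* ∣ β ∣ ℕ.≤ M →
                   0ℤ ≤ + M * (x * x + y * y) + + 2 * + L * (x * y * β)
cross-term-bound M L x y (+ b) L∣β∣≤M = subst (0ℤ ≤_) (sym certificate)
  (+-nonNeg (*-nonNeg (*-nonNeg (nat-nonNeg L) (nat-nonNeg b)) (square-nonNeg (x + y)))
            (*-nonNeg (nat-nonNeg r) (+-nonNeg (square-nonNeg x) (square-nonNeg y))))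
  where
  r = M ℕ.∸ L ℕ.* b
  identity : ∀ L b r x y → (L * b + r) * (x * x + y * y) + + 2 * L * (x * y * b) ≡
                           L * b * ((x + y) * (x + y)) + r * (x * x + y * y)
  identity = solve-∀
  certificate : + M * (x * x + y * y) + + 2 * + L * (x * y * + b) ≡
                + L * + b * ((x + y) * (x + y)) + + r * (x * x + y * y)
  certificate = trans (cong (λ μ → μ * (x * x + y * y) + + 2 * + L * (x * y * + b)) (split-below {M} {L} {b} L∣β∣≤M))
                      (identity (+ L) (+ b) (+ r) x y)
cross-term-bound M L x y -[1+ b ] L∣β∣≤M = subst (0ℤ ≤_) (sym certificate)
  (+-nonNeg (*-nonNeg (*-nonNeg (nat-nonNeg L) (nat-nonNeg (suc b))) (square-nonNeg (x - y)))
            (*-nonNeg (nat-nonNeg r) (+-nonNeg (square-nonNeg x) (square-nonNeg y))))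
  where
  r = M ℕ.∸ L ℕ.* suc b
  identity : ∀ L b r x y → (L * b + r) * (x * x + y * y) + + 2 * L * (x * y * - b) ≡
                           L * b * ((x - y) * (x - y)) + r * (x * x + y * y)
  identity = solve-∀
  certificate : + M * (x * x + y * y) + + 2 * + L * (x * y * -[1+ b ]) ≡
                + L * + suc b * ((x - y) * (x - y)) + + r * (x * x + y * y)
  certificate = trans (cong (λ μ → μ * (x * x + y * y) + + 2 * + L * (x * y * -[1+ b ])) (split-below {M} {L} {suc b} L∣β∣≤M))
                      (identity (+ L) (+ suc b) (+ r) x y)

normSq-shift-lower : ∀ {N} m (c w : Vecℤ N) →
                     m * m * normSq c + + 2 * m * dot c w ≤ normSq (λ i → m * c i + w i)
normSq-shift-lower {N} m c w = begin
  m * m * normSq c + + 2 * m * dot c w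
    ≡⟨ cong₂ _+_ (sumF-*ˡ {N} (m * m) _) (sumF-*ˡ {N} (+ 2 * m) _) ⟨
  sumF (λ i → m * m * (c i * c i)) + sumF (λ i → + 2 * m * (c i * w i))
    ≡⟨ sumF-+ {N} _ _ ⟨
  sumF (λ i → m * m * (c i * c i) + + 2 * m * (c i * w i))
    ≤⟨ sumF-mono (λ i → 0≤i-j⇒j≤i (subst (0ℤ ≤_) (sym (expansion m (c i) (w i))) (square-nonNeg (w i)))) ⟩
  normSq (λ i → m * c i + w i) ∎
  where
  open ≤-Reasoning
  expansion : ∀ m c w → (m * c + w) * (m * c + w) - (m * m * (c * c) + + 2 * m * (c * w)) ≡ w * w
  expansion = solve-∀

cross-sum-bound : ∀ {N} (M L : ℕ) (c : Vecℤ N) (B : Fin N → Vecℤ N) → (∀ t i → L ℕ.* ∣ B t i ∣ ℕ.≤ M) →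
                  - (+ 2 * + N * + M * normSq c) ≤ + 2 * + L * dot c (linComb B c)
cross-sum-bound {N} M L c B bound =
  0≤i-j⇒j≤i (subst (0ℤ ≤_) double-sum
    (sumF-nonNeg (λ i → sumF-nonNeg (λ t → cross-term-bound M L (c i) (c t) (B t i) (bound t i)))))
  where
  open ≡-Reasoning
  m = + M
  C = normSq c
  S = dot c (linComb B c)
  ΣN : (Fin N → ℤ) → ℤ
  ΣN = sumF
  inner : ∀ i → ΣN (λ t → m * (c i * c i + c t * c t) + + 2 * + L * (c i * c t * B t i)) ≡
                m * (+ N * (c i * c i) + C) + + 2 * + L * (c i * linComb B c i)
  inner i = begin
    ΣN (λ t → m * (c i * c i + c t * c t) + + 2 * + L * (c i * c t * B t i))
      ≡⟨ sumF-+ {N} _ _ ⟩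
    ΣN (λ t → m * (c i * c i + c t * c t)) + ΣN (λ t → + 2 * + L * (c i * c t * B t i))
      ≡⟨ cong₂ _+_ (trans (sumF-*ˡ {N} m _) (cong (m *_) (trans (sumF-+ {N} _ _) (cong (_+ C) (sumF-const {N} _)))))
                   (trans (sumF-*ˡ {N} (+ 2 * + L) _)
                          (cong (+ 2 * + L *_) (trans (sumF-cong (λ t → *-assoc (c i) (c t) (B t i)))
                                                      (sumF-*ˡ {N} (c i) _)))) ⟩
    m * (+ N * (c i * c i) + C) + + 2 * + L * (c i * linComb B c i) ∎
  double-sum : ΣN (λ i → ΣN (λ t → m * (c i * c i + c t * c t) + + 2 * + L * (c i * c t * B t i))) ≡
               + 2 * + L * S - - (+ 2 * + N * m * C)
  double-sum = begin
    ΣN (λ i → ΣN (λ t → m * (c i * c i + c t * c t) + + 2 * + L * (c i * c t * B t i)))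
      ≡⟨ sumF-cong inner ⟩
    ΣN (λ i → m * (+ N * (c i * c i) + C) + + 2 * + L * (c i * linComb B c i))
      ≡⟨ sumF-+ {N} _ _ ⟩
    ΣN (λ i → m * (+ N * (c i * c i) + C)) + ΣN (λ i → + 2 * + L * (c i * linComb B c i))
      ≡⟨ cong₂ _+_ (trans (sumF-*ˡ {N} m _) (cong (m *_) (trans (sumF-+ {N} _ _)
                     (cong₂ _+_ (sumF-*ˡ {N} (+ N) _) (sumF-const {N} C)))))
                   (sumF-*ˡ {N} (+ 2 * + L) _) ⟩
    m * (+ N * C + + N * C) + + 2 * + L * S
      ≡⟨ regroup m (+ N) C (+ L) S ⟩
    + 2 * + L * S - - (+ 2 * + N * m * C) ∎
    where
    regroup : ∀ m n C L S → m * (n * C + n * C) + + 2 * L * S ≡ + 2 * L * S - - (+ 2 * n * m * C)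
    regroup = solve-∀

-- Write the vector as M c + w with w = Σ_t c_t B_t; since every |B_ti| ≤ M/L,
-- the cross term 2M⟨c, w⟩ costs at most a fraction 2N/L of M²|c|².
perturbed-identity-lower-bound : ∀ {N} (M L : ℕ) (c : Vecℤ N) (B : Fin N → Vecℤ N) →
  (∀ t i → L ℕ.* ∣ B t i ∣ ℕ.≤ M) →
  (+ L - + 2 * + N) * (+ M * + M) * normSq c ≤ + L * normSq (λ i → + M * c i + linComb B c i)
perturbed-identity-lower-bound {N} M L c B bound = begin
  (+ L - + 2 * + N) * (m * m) * C
    ≡⟨ regroup (+ L) (+ N) m C ⟩
  + L * (m * m * C) + m * - (+ 2 * + N * m * C)
    ≤⟨ +-monoʳ-≤ (+ L * (m * m * C)) (*-monoˡ-≤-nonNeg m (cross-sum-bound M L c B bound)) ⟩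
  + L * (m * m * C) + m * (+ 2 * + L * S)
    ≡⟨ regroup′ (+ L) m C S ⟩
  + L * (m * m * C + + 2 * m * S)
    ≤⟨ *-monoˡ-≤-nonNeg (+ L) (normSq-shift-lower m c (linComb B c)) ⟩
  + L * normSq (λ i → m * c i + linComb B c i) ∎
  where
  open ≤-Reasoning
  m = + M
  C = normSq c
  S = dot c (linComb B c)
  regroup : ∀ L N m C → (L - + 2 * N) * (m * m) * C ≡ L * (m * m * C) + m * - (+ 2 * N * m * C)
  regroup = solve-∀
  regroup′ : ∀ L m C S → L * (m * m * C) + m * (+ 2 * L * S) ≡ L * (m * m * C + + 2 * m * S)
  regroup′ = solve-∀

square≡∣∣² : ∀ x → x * x ≡ + ∣ x ∣ * + ∣ x ∣
square≡∣∣² x = trans (sym (0≤i⇒+∣i∣≡i (square-nonNeg x))) (trans (cong +_ (abs-* x x)) (pos-* ∣ x ∣ ∣ x ∣))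

square-dominated : ∀ (L M : ℕ) x → L ℕ.* ∣ x ∣ ℕ.≤ M → + L * + L * (x * x) ≤ + M * + M
square-dominated L M x L∣x∣≤M = begin
  + L * + L * (x * x)                     ≡⟨ cong (+ L * + L *_) (square≡∣∣² x) ⟩
  + L * + L * (+ ∣ x ∣ * + ∣ x ∣)         ≡⟨ regroup (+ L) (+ ∣ x ∣) ⟩
  + L * + ∣ x ∣ * (+ L * + ∣ x ∣)         ≡⟨ cong₂ _*_ (pos-* L ∣ x ∣) (pos-* L ∣ x ∣) ⟨
  + (L ℕ.* ∣ x ∣) * + (L ℕ.* ∣ x ∣)       ≡⟨ pos-* (L ℕ.* ∣ x ∣) _ ⟨
  + (L ℕ.* ∣ x ∣ ℕ.* (L ℕ.* ∣ x ∣))       ≤⟨ +≤+ (ℕ.*-mono-≤ L∣x∣≤M L∣x∣≤M) ⟩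
  + (M ℕ.* M)                             ≡⟨ pos-* M M ⟩
  + M * + M                               ∎
  where
  open ≤-Reasoning
  regroup : ∀ l y → l * l * (y * y) ≡ l * y * (l * y)
  regroup = solve-∀

-- Vectors with a dominant first entry

ℓ : ℕ → ℕ
ℓ n = 4 ℕ.* suc n ℕ.+ 1

SignedRotation : ∀ {N} → Vecℤ N → Vecℤ N → Set
SignedRotation a v = ∃ λ j → ∃ λ s → IsUnit s × v ≐ (λ i → s * orbit a j i)

module DominantFirstEntry (n : ℕ) (a : Vecℤ (suc n)) (M′ : ℕ) (a₀≡M : a zero ≡ + suc M′)
                          (dominated : ∀ i → ℓ n ℕ.* ∣ a (suc i) ∣ ℕ.≤ suc M′) where

  N = suc n
  M = suc M′
  m = + M
  L = ℓ n

  rest : Vecℤ N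
  rest zero    = 0ℤ
  rest (suc i) = a (suc i)

  B : Fin N → Vecℤ N
  B t i = rest (back^ (toℕ t) i)

  orbit-split : ∀ t i → orbit a t i ≡ m * δ i t + B t i
  orbit-split t i with back^ (toℕ t) i in eq
  ... | zero  = begin
    rotPow (toℕ t) a i  ≡⟨ rotPow-back^ (toℕ t) a i ⟩
    a (back^ (toℕ t) i) ≡⟨ cong a eq ⟩
    a zero              ≡⟨ a₀≡M ⟩
    m                   ≡⟨ trans (+-identityʳ (m * 1ℤ)) (*-identityʳ m) ⟨
    m * 1ℤ + 0ℤ         ≡⟨ cong (λ d → m * d + 0ℤ) (δ-diag i) ⟨
    m * δ i i + 0ℤ      ≡⟨ cong (λ u → m * δ i u + 0ℤ) (back^-zero⇒ t i eq) ⟨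
    m * δ i t + 0ℤ      ∎
    where open ≡-Reasoning
  ... | suc k = begin
    rotPow (toℕ t) a i  ≡⟨ rotPow-back^ (toℕ t) a i ⟩
    a (back^ (toℕ t) i) ≡⟨ cong a eq ⟩
    a (suc k)           ≡⟨ +-identityˡ _ ⟨
    0ℤ + a (suc k)      ≡⟨ cong (λ d → d + a (suc k)) (trans (cong (m *_) (δ-offDiag i t t≢i)) (*-zeroʳ m)) ⟨
    m * δ i t + a (suc k) ∎
    where
    open ≡-Reasoning
    t≢i : t ≢ i
    t≢i refl with () ← trans (sym (back^-self t)) eq

  linComb-split : ∀ c i → linComb (orbit a) c i ≡ m * c i + linComb B c i
  linComb-split c i = begin
    sumF (λ t → c t * orbit a t i)                   ≡⟨ sumF-cong (λ t → cong (c t *_) (orbit-split t i)) ⟩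
    sumF (λ t → c t * (m * δ i t + B t i))           ≡⟨ sumF-cong (λ t → distribute m (c t) (δ i t) (B t i)) ⟩
    sumF (λ t → m * (c t * δ i t) + c t * B t i)     ≡⟨ sumF-+ (λ t → m * (c t * δ i t)) (λ t → c t * B t i) ⟩
    sumF (λ t → m * (c t * δ i t)) + linComb B c i   ≡⟨ cong (_+ linComb B c i) (sumF-*ˡ m (λ t → c t * δ i t)) ⟩
    m * sumF (λ t → c t * δ i t) + linComb B c i     ≡⟨ cong (λ z → m * z + linComb B c i) (sumF-*δ c i) ⟩
    m * c i + linComb B c i                          ∎
    where
    open ≡-Reasoning
    distribute : ∀ m c d b → c * (m * d + b) ≡ m * (c * d) + c * b
    distribute = solve-∀

  K : ℤ
  K = + 2 * + N + 1ℤ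

  L≡4N+1 : + L ≡ + 4 * + N + 1ℤ
  L≡4N+1 = trans (pos-+ (4 ℕ.* N) 1) (cong (_+ 1ℤ) (pos-* 4 N))

  B-dominated : ∀ t i → L ℕ.* ∣ B t i ∣ ℕ.≤ M
  B-dominated t i = rest-dominated (back^ (toℕ t) i)
    where
    rest-dominated : ∀ i → L ℕ.* ∣ rest i ∣ ℕ.≤ M
    rest-dominated zero    = subst (ℕ._≤ M) (sym (ℕ.*-zeroʳ L)) ℕ.z≤n
    rest-dominated (suc i) = dominated i

  lower-bound : ∀ c → K * (m * m) * normSq c ≤ + L * normSq (linComb (orbit a) c)
  lower-bound c = subst₂ _≤_ (cong (λ k → k * (m * m) * normSq c) L-2N≡K)
                             (cong (+ L *_) (sym (normSq-cong (linComb-split c))))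
                             (perturbed-identity-lower-bound M L c B B-dominated)
    where
    L-2N≡K : + L - + 2 * + N ≡ K
    L-2N≡K = trans (cong (λ l → l - + 2 * + N) L≡4N+1) (simplify (+ N))
      where
      simplify : ∀ N → + 4 * N + 1ℤ - + 2 * N ≡ + 2 * N + 1ℤ
      simplify = solve-∀

  upper-bound : + L * + L * normSq a ≤ (+ L * + L + + n) * (m * m)
  upper-bound = begin
    + L * + L * (a zero * a zero + sumF (λ i → a (suc i) * a (suc i)))
      ≡⟨ *-distribˡ-+ (+ L * + L) (a zero * a zero) _ ⟩
    + L * + L * (a zero * a zero) + + L * + L * sumF (λ i → a (suc i) * a (suc i))
      ≡⟨ cong₂ _+_ (cong (λ z → + L * + L * (z * z)) a₀≡M) (sym (sumF-*ˡ {n} (+ L * + L) _)) ⟩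
    + L * + L * (m * m) + sumF (λ i → + L * + L * (a (suc i) * a (suc i)))
      ≤⟨ +-monoʳ-≤ (+ L * + L * (m * m)) (sumF-mono (λ i → square-dominated L M (a (suc i)) (dominated i))) ⟩
    + L * + L * (m * m) + sumF {n} (λ _ → m * m)
      ≡⟨ cong (_+_ (+ L * + L * (m * m))) (sumF-const {n} (m * m)) ⟩
    + L * + L * (m * m) + + n * (m * m)
      ≡⟨ *-distribʳ-+ (m * m) (+ L * + L) (+ n) ⟨
    (+ L * + L + + n) * (m * m) ∎
    where open ≤-Reasoning

  -- With L = 4N + 1 we have L + 1 = 2K and n < L, so |v|² ≥ 2K m²/L beats |a|² ≤ (1 + n/L²) m².
  longer-than-a : ∀ c → + 2 ≤ normSq c → normSq a < normSq (linComb (orbit a) c)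
  longer-than-a c 2≤C = *-cancelˡ-<-nonNeg (+ L * + L) (begin-strict
    + L * + L * normSq a                 ≤⟨ upper-bound ⟩
    (+ L * + L + + n) * (m * m)          <⟨ *-monoʳ-<-pos (m * m) (+-monoʳ-< (+ L * + L) n<L) ⟩
    (+ L * + L + + L) * (m * m)          ≡⟨ regroup (+ L) (+ N) (m * m) L≡4N+1 ⟩
    + L * (K * (m * m) * + 2)            ≤⟨ *-monoˡ-≤-nonNeg (+ L) (*-monoˡ-≤-nonNeg (K * (m * m)) 2≤C) ⟩
    + L * (K * (m * m) * normSq c)       ≤⟨ *-monoˡ-≤-nonNeg (+ L) (lower-bound c) ⟩
    + L * (+ L * normSq v)               ≡⟨ *-assoc (+ L) (+ L) _ ⟨
    + L * + L * normSq v                 ∎)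
    where
    open ≤-Reasoning
    v = linComb (orbit a) c
    n<L : + n < + L
    n<L = +<+ (ℕ.≤-trans (ℕ.n<1+n n) (ℕ.≤-trans (ℕ.m≤n*m N 4) (ℕ.m≤m+n (4 ℕ.* N) 1)))
    regroup : ∀ l N μ → l ≡ + 4 * N + 1ℤ → (l * l + l) * μ ≡ l * ((+ 2 * N + 1ℤ) * μ * + 2)
    regroup _ N μ refl = expand N μ
      where
      expand : ∀ N μ → ((+ 4 * N + 1ℤ) * (+ 4 * N + 1ℤ) + (+ 4 * N + 1ℤ)) * μ ≡
                       (+ 4 * N + 1ℤ) * ((+ 2 * N + 1ℤ) * μ * + 2)
      expand = solve-∀

  orbit-linIndep : LinIndep (orbit a)
  orbit-linIndep c vanish = normSq≡0⇒zero c (≤-antisym C≤0 (normSq-nonNeg c))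
    where
    C≤0 : normSq c ≤ 0ℤ
    C≤0 = *-cancelˡ-≤-pos (normSq c) 0ℤ (K * (m * m)) (begin
      K * (m * m) * normSq c                        ≤⟨ lower-bound c ⟩
      + L * normSq (linComb (orbit a) c)            ≡⟨ cong (+ L *_) (normSq-zero vanish) ⟩
      + L * 0ℤ                                      ≡⟨ *-zeroʳ (+ L) ⟩
      0ℤ                                            ≡⟨ *-zeroʳ (K * (m * m)) ⟨
      K * (m * m) * 0ℤ                              ∎)
      where open ≤-Reasoning

  short-vectors : ∀ v → Λ a v → v ≐ (λ _ → 0ℤ) ⊎ SignedRotation a v ⊎ normSq a < normSq v
  short-vectors v (c , v≐) with normSq-trichotomy c
  ... | inj₁ C≡0 = inj₁ (λ i → trans (v≐ i) (linComb-zero (orbit a) (normSq≡0⇒zero c C≡0) i))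
  ... | inj₂ (inj₂ 2≤C) = inj₂ (inj₂ (subst (normSq a <_) (sym (normSq-cong v≐)) (longer-than-a c 2≤C)))
  ... | inj₂ (inj₁ C≡1) with normSq≡1⇒signedBasis c C≡1
  ...   | j , s , unit , cj≡s , off-j≡0 = inj₂ (inj₁ (j , s , unit , λ i →
          trans (v≐ i) (trans (linComb-single (orbit a) c j off-j≡0 i) (cong (_* orbit a j i) cj≡s))))

  normSq-signedRotation : ∀ {v} → SignedRotation a v → normSq v ≡ normSq a
  normSq-signedRotation (j , s , unit , v≐) =
    trans (normSq-cong v≐) (trans (normSq-scale unit (orbit a j)) (normSq-rotPow (toℕ j) a))

  a₀≢0 : a zero ≢ 0ℤ
  a₀≢0 a₀≡0 with () ← trans (sym a₀≡M) a₀≡0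

  shortest : ∀ v → Λ a v → ¬ (v ≐ (λ _ → 0ℤ)) → normSq a ≤ normSq v
  shortest v v∈Λ v≢0 with short-vectors v v∈Λ
  ... | inj₁ v≡0             = ⊥-elim (v≢0 v≡0)
  ... | inj₂ (inj₁ rotation) = ≤-reflexive (sym (normSq-signedRotation rotation))
  ... | inj₂ (inj₂ longer)   = <⇒≤ longer

  shortest-in-ball : ∀ {k} s → IndepInBall (Λ a) (suc k) s → normSq a ≤ s
  shortest-in-ball s (vs , mem , indep , inBall) =
    ≤-trans (shortest (vs zero) (mem zero) (linIndep⇒nonzero {vs = vs} indep zero)) (inBall zero)

  λ₁ : SuccMinSq (Λ a) 1 (normSq a)
  λ₁ = ((λ _ → a) , (λ _ → orbit∈Λ a zero) , linIndep-single a zero a₀≢0 , (λ _ → ≤-refl)) , shortest-in-ball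

  λN : SuccMinSq (Λ a) N (normSq a)
  λN = (orbit a , orbit∈Λ a , orbit-linIndep , (λ j → ≤-reflexive (normSq-rotPow (toℕ j) a))) , shortest-in-ball

  minimal⇒signedRotation : ∀ c → InS (Λ a) c → SignedRotation a c
  minimal⇒signedRotation c (c∈Λ , ball , minimal) with short-vectors c c∈Λ
  ... | inj₂ (inj₁ rotation) = rotation
  ... | inj₂ (inj₂ longer)   = ⊥-elim (<⇒≱ longer (minimal (normSq a) (proj₁ λ₁)))
  ... | inj₁ c≡0             =
    ⊥-elim (<⇒≱ 0<a (≤-trans (shortest-in-ball _ ball) (≤-reflexive (normSq-zero c≡0))))
    where
    0<a : 0ℤ < normSq a
    0<a = <-≤-trans (+<+ (ℕ.s≤s ℕ.z≤n)) (≤-trans (square-pos (a zero) a₀≢0) (square≤normSq a zero))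

  Λ∈ℛ′ : InR' N (Λ a)
  Λ∈ℛ′ = (a , (λ _ → (λ v∈Λ → v∈Λ) , (λ v∈Λ → v∈Λ)) , (Λ-cyclic a , full-rank) , λ₁ , λN) , minimal-full-co
    where
    full-rank : HasRank (Λ a) N
    full-rank = hasRank-full {Γ = Λ a} (orbit a) (orbit∈Λ a) orbit-linIndep
    minimal-full-co : ∀ c → InS (Λ a) c → CoIs c N
    minimal-full-co c c∈S with minimal⇒signedRotation c c∈S
    ... | j , s , unit , c≐ = co-signedRotation a orbit-linIndep j unit c c≐

-- The vector built from least common multiples

lcm≢0 : ∀ x y → x ≢ 0 → y ≢ 0 → lcm x y ≢ 0
lcm≢0 x y x≢0 y≢0 lcm≡0 with ℕ.m*n≡0⇒m≡0∨n≡0 x (trans (sym (gcd*lcm x y))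
                                 (trans (cong (gcd x y ℕ.*_) lcm≡0) (ℕ.*-zeroʳ (gcd x y))))
... | inj₁ x≡0 = x≢0 x≡0
... | inj₂ y≡0 = y≢0 y≡0

lcmF-positive : ∀ {n} (k : Fin n → ℤ) → (∀ i → NonZero (k i)) → ∃ λ M′ → lcmF k ≡ + suc M′
lcmF-positive {zero}  k nz = 0 , refl
lcmF-positive {suc n} k nz with lcmF-positive (k ∘ suc) (nz ∘ suc)
... | _ , tail≡ with lcm ∣ k zero ∣ ∣ lcmF (k ∘ suc) ∣ in lcm≡
...   | suc M′ = M′ , refl
...   | zero   = ⊥-elim (lcm≢0 _ _ (ℕ.≢-nonZero⁻¹ ∣ k zero ∣ {{nz zero}}) tail≢0 lcm≡)
  where
  tail≢0 : ∣ lcmF (k ∘ suc) ∣ ≢ 0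
  tail≢0 e with () ← trans (sym (cong ∣_∣ tail≡)) e

quotient-dominated : ∀ (M L : ℕ) k .{{_ : NonZero k}} → L ℕ.≤ ∣ k ∣ → L ℕ.* ∣ + M / k ∣ ℕ.≤ M
quotient-dominated M L k L≤∣k∣ = begin
  L ℕ.* ∣ + M / k ∣               ≡⟨ cong (L ℕ.*_) ∣M/k∣≡ ⟩
  L ℕ.* (M ℕ./ ∣ k ∣)             ≤⟨ ℕ.*-monoˡ-≤ (M ℕ./ ∣ k ∣) L≤∣k∣ ⟩
  ∣ k ∣ ℕ.* (M ℕ./ ∣ k ∣)         ≡⟨ ℕ.*-comm ∣ k ∣ _ ⟩
  M ℕ./ ∣ k ∣ ℕ.* ∣ k ∣           ≤⟨ m/n*n≤m M ∣ k ∣ ⟩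
  M                               ∎
  where
  open ℕ.≤-Reasoning
  ∣M/k∣≡ : ∣ + M / k ∣ ≡ M ℕ./ ∣ k ∣
  ∣M/k∣≡ = trans (abs-* (sign k ◃ 1) (+ (M ℕ./ ∣ k ∣)))
                 (trans (cong (ℕ._* (M ℕ./ ∣ k ∣)) (abs-◃ (sign k) 1)) (ℕ.*-identityˡ _))

corollary3p9 : (n : ℕ) → 1 ℕ.≤ n →
    Σ ℕ λ l → 1 ℕ.≤ l ×
    ((k : Fin n → ℤ) (nz : ∀ i → NonZero (k i)) → (∀ i → l ℕ.≤ ∣ k i ∣) →
    InR' (suc n) (Λ (aVec k nz)))
corollary3p9 n _ = ℓ n , ℕ.m≤n+m 1 (4 ℕ.* suc n) , λ k nz large → Λ∈ℛ′-aVec k nz large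
  where
  Λ∈ℛ′-aVec : ∀ k nz → (∀ i → ℓ n ℕ.≤ ∣ k i ∣) → InR' (suc n) (Λ (aVec k nz))
  Λ∈ℛ′-aVec k nz large with lcmF-positive k nz
  ... | M′ , lcm≡ = DominantFirstEntry.Λ∈ℛ′ n (aVec k nz) M′ lcm≡ dominated
    where
    dominated : ∀ i → ℓ n ℕ.* ∣ aVec k nz (suc i) ∣ ℕ.≤ suc M′
    dominated i rewrite lcm≡ = quotient-dominated (suc M′) (ℓ n) (k i) {{nz i}} (large i)
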